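{- Let $v\in\mathrm{Val}(\forall\alpha.\alpha\times\alpha\to\alpha)$. If there exists a closed type $\tau$ such that $v[\tau]$ may-diverges, then $\emptyset;\emptyset\vdash v\cong^{ctx}_{\Downarrow}\Lambda\alpha.\,\Omega[\alpha\times\alpha\to\alpha]:\forall\alpha.\alpha\times\alpha\to\alpha$.
   Context: Language. Types: $\tau ::= \alpha \mid \mathbf{1} \mid \tau_1\times\tau_2 \mid \tau_1\to\tau_2 \mid \mu\alpha.(\tau_1+\dots+\tau_n) \mid \forall\alpha.\tau$. Values: $v ::= x \mid \langle\rangle \mid \langle v_1,v_2\rangle \mid \lambda x.e \mid \mathsf{in}_i\,v \mid \Lambda\alpha.e$. Terms: $e ::= v \mid ? \mid \mathsf{proj}_i\,v \mid v\,e \mid \mathsf{case}\,v\,\mathsf{of}\,(\mathsf{in}_1 x_1\Rightarrow e_1\mid\dots\mid \mathsf{in}_n x_n\Rightarrow e_n) \mid v[\tau]$. Evaluation contexts $E ::= [\,]\mid v\,E$. Reduction $\mapsto$: $\mathsf{proj}_i\langle v_1,v_2\rangle\mapsto v_i$; $(\lambda x.e)\,v\mapsto e[v/x]$; $(\Lambda\alpha.e)[\tau]\mapsto e[\tau/\alpha]$; $\mathsf{case}\,(\mathsf{in}_j v)\,\mathsf{of}(\dots\mid\mathsf{in}_j x_j\Rightarrow e_j\mid\dots)\mapsto e_j[v/x_j]$; $?\mapsto\underline n$ for each $n\in\mathbb N$ ($\mathsf{nat}=\mu\alpha.(\mathbf 1+\alpha)$, $\underline 0=\mathsf{in}_1\langle\rangle$,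 $\underline{n+1}=\mathsf{in}_2\underline n$); $v\,e\mapsto v\,e'$ if $e\mapsto e'$. Typing is standard for this call-by-value polymorphic lambda calculus with iso-recursive sums and $?:\mathsf{nat}$; $\mathrm{Val}(\tau)$ = closed values of closed type $\tau$. $e$ may-diverges if there is an infinite reduction sequence from $e$; $e\Downarrow$ (must-converges) if it does not may-diverge. $\Omega$ denotes the closed value $\Lambda\alpha.\,\mathsf{fix}[\mathbf 1][\alpha]\,(\lambda f.f)\,\langle\rangle$ of type $\forall\alpha.\alpha$, where $\mathsf{fix}=\Lambda\alpha.\Lambda\beta.\lambda f.\,\delta_f\,(\mathsf{in}\,\delta_f)$, $\delta_f=\lambda y.\,\mathsf{case}\,y\,\mathsf{of}\,(\mathsf{in}\,y'\Rightarrow f(\lambda x.\,(\lambda r.r\,x)(y'\,y)))$ with $\mathsf{in}$ the injection into $\mu\gamma.(\gamma\to(\alpha\to\beta))$ (multiple applications abbreviating the corresponding let-sequences $(\lambda x.e')e$); for every closed $\tau$, reduction of $\Omega[\tau]$ is deterministic and non-terminating. A type-indexed relation is a set of tuples $(\Delta,\Gamma,e,e',\tau)$ with $e,e'$ both of type $\tau$ in $\Delta;\Gamma$; compatible if it relates each variable to itself, $\langle\rangle$ to $\langle\rangle$, $?$ to $?$, and terms built by the same constructor from related immediate subterms; a precongruence is reflexive, transitive and compatible; must-adequate if whenever it relates closed $e,e'$, $e\Downarrow\Rightarrow e'\Downarrow$. $\lesssim^{ctx}_{\Downarrow}$ is the largest must-adequate precongruence and $\cong^{ctx}_{\Downarrow}$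 its symmetrization. -}

module Defs where

open import Data.Nat using (ℕ; zero; suc)
open import Data.Fin using (Fin; zero; suc; toℕ)
open import Data.List using (List; []; _∷_; length)
import Data.List as L
open import Data.Vec using (Vec; []; _∷_; lookup)
import Data.Vec as V
open import Data.Product using (_×_; ∃; Σ)
open import Relation.Binary.PropositionalEquality using (_≡_)
open import Relation.Nullary using (¬_)
open import Level using (Level) renaming (suc to lsuc)

-- Types (de Bruijn; Ty m = types with m free type variables)
-- μΣ τs  is  μα.(τ₁ + … + τₖ)  (the bound α is variable zero in each τᵢ)

data Ty (m : ℕ) : Set where
  tv   : Fin m → Ty m
  𝟙    : Ty m
  _⊗_  : Ty m → Ty m → Ty m
  _⇒_  : Ty m → Ty m → Ty m
  μΣ   : List (Ty (suc m)) → Ty m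
  ∀'   : Ty (suc m) → Ty m

infixr 7 _⇒_
infixr 8 _⊗_

extR : ∀ {m k} → (Fin m → Fin k) → Fin (suc m) → Fin (suc k)
extR ρ zero    = zero
extR ρ (suc i) = suc (ρ i)

mutual
  ren : ∀ {m k} → (Fin m → Fin k) → Ty m → Ty k
  ren ρ (tv i)   = tv (ρ i)
  ren ρ 𝟙        = 𝟙
  ren ρ (a ⊗ b)  = ren ρ a ⊗ ren ρ b
  ren ρ (a ⇒ b)  = ren ρ a ⇒ ren ρ b
  ren ρ (μΣ τs)  = μΣ (renL (extR ρ) τs)
  ren ρ (∀' τ)   = ∀' (ren (extR ρ) τ)

  renL : ∀ {m k} → (Fin m → Fin k) → List (Ty m) → List (Ty k)
  renL ρ []       = []
  renL ρ (t ∷ ts) = ren ρ t ∷ renL ρ ts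

extS : ∀ {m k} → (Fin m → Ty k) → Fin (suc m) → Ty (suc k)
extS σ zero    = tv zero
extS σ (suc i) = ren suc (σ i)

mutual
  sub : ∀ {m k} → (Fin m → Ty k) → Ty m → Ty k
  sub σ (tv i)   = σ i
  sub σ 𝟙        = 𝟙
  sub σ (a ⊗ b)  = sub σ a ⊗ sub σ b
  sub σ (a ⇒ b)  = sub σ a ⇒ sub σ b
  sub σ (μΣ τs)  = μΣ (subL (extS σ) τs)
  sub σ (∀' τ)   = ∀' (sub (extS σ) τ)

  subL : ∀ {m k} → (Fin m → Ty k) → List (Ty m) → List (Ty k)
  subL σ []       = []
  subL σ (t ∷ ts) = sub σ t ∷ subL σ ts

single : ∀ {m} → Ty m → Fin (suc m) → Ty m
single s zero    = s
single s (suc i) = tv i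

_[_]ᵗ : ∀ {m} → Ty (suc m) → Ty m → Ty m
τ [ s ]ᵗ = sub (single s) τ

unfold : ∀ {m} (τs : List (Ty (suc m))) → Fin (length τs) → Ty m
unfold τs j = L.lookup τs j [ μΣ τs ]ᵗ

nat : ∀ {m} → Ty m
nat = μΣ (𝟙 ∷ tv zero ∷ [])

-- Terms: Val m n / Tm m n with m free type variables, n free term variables.
-- inj i v  is  in_{i+1} v  (0-based injection index).

mutual
  data Val (m n : ℕ) : Set where
    var  : Fin n → Val m n
    ⟨⟩   : Val m n
    pair : Val m n → Val m n → Val m n
    lam  : Tm m (suc n) → Val m n
    inj  : ℕ → Val m n → Val m n
    tlam : Tm (suc m) n → Val m n

  data Tm (m n : ℕ) : Set where
    val  : Val m n → Tm m n
    ¿    : Tm m n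
    fst  : Val m n → Tm m n
    snd  : Val m n → Tm m n
    app  : Val m n → Tm m n → Tm m n
    case : Val m n → List (Tm m (suc n)) → Tm m n
    tapp : Val m n → Ty m → Tm m n

mutual
  renV : ∀ {m n k} → (Fin n → Fin k) → Val m n → Val m k
  renV ρ (var x)    = var (ρ x)
  renV ρ ⟨⟩         = ⟨⟩
  renV ρ (pair a b) = pair (renV ρ a) (renV ρ b)
  renV ρ (lam e)    = lam (renT (extR ρ) e)
  renV ρ (inj i v)  = inj i (renV ρ v)
  renV ρ (tlam e)   = tlam (renT ρ e)

  renT : ∀ {m n k} → (Fin n → Fin k) → Tm m n → Tm m k
  renT ρ (val v)     = val (renV ρ v)
  renT ρ ¿           = ¿
  renT ρ (fst v)     = fst (renV ρ v)
  renT ρ (snd v)     = snd (renV ρ v)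
  renT ρ (app v e)   = app (renV ρ v) (renT ρ e)
  renT ρ (case v es) = case (renV ρ v) (renTs (extR ρ) es)
  renT ρ (tapp v τ)  = tapp (renV ρ v) τ

  renTs : ∀ {m n k} → (Fin n → Fin k) → List (Tm m n) → List (Tm m k)
  renTs ρ []       = []
  renTs ρ (e ∷ es) = renT ρ e ∷ renTs ρ es

mutual
  trenV : ∀ {m k n} → (Fin m → Fin k) → Val m n → Val k n
  trenV ρ (var x)    = var x
  trenV ρ ⟨⟩         = ⟨⟩
  trenV ρ (pair a b) = pair (trenV ρ a) (trenV ρ b)
  trenV ρ (lam e)    = lam (trenT ρ e)
  trenV ρ (inj i v)  = inj i (trenV ρ v)
  trenV ρ (tlam e)   = tlam (trenT (extR ρ) e)

  trenT : ∀ {m k n} → (Fin m → Fin k) → Tm m n → Tm k n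
  trenT ρ (val v)     = val (trenV ρ v)
  trenT ρ ¿           = ¿
  trenT ρ (fst v)     = fst (trenV ρ v)
  trenT ρ (snd v)     = snd (trenV ρ v)
  trenT ρ (app v e)   = app (trenV ρ v) (trenT ρ e)
  trenT ρ (case v es) = case (trenV ρ v) (trenTs ρ es)
  trenT ρ (tapp v τ)  = tapp (trenV ρ v) (ren ρ τ)

  trenTs : ∀ {m k n} → (Fin m → Fin k) → List (Tm m n) → List (Tm k n)
  trenTs ρ []       = []
  trenTs ρ (e ∷ es) = trenT ρ e ∷ trenTs ρ es

extV : ∀ {m n k} → (Fin n → Val m k) → Fin (suc n) → Val m (suc k)
extV σ zero    = var zero
extV σ (suc i) = renV suc (σ i)

textV : ∀ {m n k} → (Fin n → Val m k) → Fin n → Val (suc m) k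
textV σ i = trenV suc (σ i)

mutual
  substV : ∀ {m n k} → (Fin n → Val m k) → Val m n → Val m k
  substV σ (var x)    = σ x
  substV σ ⟨⟩         = ⟨⟩
  substV σ (pair a b) = pair (substV σ a) (substV σ b)
  substV σ (lam e)    = lam (substT (extV σ) e)
  substV σ (inj i v)  = inj i (substV σ v)
  substV σ (tlam e)   = tlam (substT (textV σ) e)

  substT : ∀ {m n k} → (Fin n → Val m k) → Tm m n → Tm m k
  substT σ (val v)     = val (substV σ v)
  substT σ ¿           = ¿
  substT σ (fst v)     = fst (substV σ v)
  substT σ (snd v)     = snd (substV σ v)
  substT σ (app v e)   = app (substV σ v) (substT σ e)
  substT σ (case v es) = case (substV σ v) (substTs (extV σ) es)
  substT σ (tapp v τ)  = tapp (substV σ v) τ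

  substTs : ∀ {m n k} → (Fin n → Val m k) → List (Tm m n) → List (Tm m k)
  substTs σ []       = []
  substTs σ (e ∷ es) = substT σ e ∷ substTs σ es

mutual
  tsubV : ∀ {m k n} → (Fin m → Ty k) → Val m n → Val k n
  tsubV σ (var x)    = var x
  tsubV σ ⟨⟩         = ⟨⟩
  tsubV σ (pair a b) = pair (tsubV σ a) (tsubV σ b)
  tsubV σ (lam e)    = lam (tsubT σ e)
  tsubV σ (inj i v)  = inj i (tsubV σ v)
  tsubV σ (tlam e)   = tlam (tsubT (extS σ) e)

  tsubT : ∀ {m k n} → (Fin m → Ty k) → Tm m n → Tm k n
  tsubT σ (val v)     = val (tsubV σ v)
  tsubT σ ¿           = ¿
  tsubT σ (fst v)     = fst (tsubV σ v)
  tsubT σ (snd v)     = snd (tsubV σ v)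
  tsubT σ (app v e)   = app (tsubV σ v) (tsubT σ e)
  tsubT σ (case v es) = case (tsubV σ v) (tsubTs σ es)
  tsubT σ (tapp v τ)  = tapp (tsubV σ v) (sub σ τ)

  tsubTs : ∀ {m k n} → (Fin m → Ty k) → List (Tm m n) → List (Tm k n)
  tsubTs σ []       = []
  tsubTs σ (e ∷ es) = tsubT σ e ∷ tsubTs σ es

singleV : ∀ {m n} → Val m n → Fin (suc n) → Val m n
singleV v zero    = v
singleV v (suc i) = var i

_[_]ᵉ : ∀ {m n} → Tm m (suc n) → Val m n → Tm m n
e [ v ]ᵉ = substT (singleV v) e

_[_]ᵀ : ∀ {m n} → Tm (suc m) n → Ty m → Tm m n
e [ τ ]ᵀ = tsubT (single τ) e

numeral : ∀ {m n} → ℕ → Val m n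
numeral zero    = inj 0 ⟨⟩
numeral (suc k) = inj 1 (numeral k)

Ctx : ℕ → ℕ → Set
Ctx m n = Vec (Ty m) n

wkCtx : ∀ {m n} → Ctx m n → Ctx (suc m) n
wkCtx Γ = V.map (ren suc) Γ

infix 4 _⊢v_⦂_ _⊢_⦂_

mutual
  data _⊢v_⦂_ : ∀ {m n} → Ctx m n → Val m n → Ty m → Set where
    var  : ∀ {m n} {Γ : Ctx m n} (x : Fin n) → Γ ⊢v var x ⦂ lookup Γ x
    unit : ∀ {m n} {Γ : Ctx m n} → Γ ⊢v ⟨⟩ ⦂ 𝟙
    pair : ∀ {m n} {Γ : Ctx m n} {a b τ₁ τ₂} →
           Γ ⊢v a ⦂ τ₁ → Γ ⊢v b ⦂ τ₂ → Γ ⊢v pair a b ⦂ τ₁ ⊗ τ₂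
    lam  : ∀ {m n} {Γ : Ctx m n} {e τ₁ τ₂} →
           (τ₁ ∷ Γ) ⊢ e ⦂ τ₂ → Γ ⊢v lam e ⦂ τ₁ ⇒ τ₂
    inj  : ∀ {m n} {Γ : Ctx m n} {τs v} (j : Fin (length τs)) →
           Γ ⊢v v ⦂ unfold τs j → Γ ⊢v inj (toℕ j) v ⦂ μΣ τs
    tlam : ∀ {m n} {Γ : Ctx m n} {e τ} →
           wkCtx Γ ⊢ e ⦂ τ → Γ ⊢v tlam e ⦂ ∀' τ

  data _⊢_⦂_ : ∀ {m n} → Ctx m n → Tm m n → Ty m → Set where
    val  : ∀ {m n} {Γ : Ctx m n} {v τ} → Γ ⊢v v ⦂ τ → Γ ⊢ val v ⦂ τ
    ¿    : ∀ {m n} {Γ : Ctx m n} → Γ ⊢ ¿ ⦂ nat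
    fst  : ∀ {m n} {Γ : Ctx m n} {v τ₁ τ₂} → Γ ⊢v v ⦂ τ₁ ⊗ τ₂ → Γ ⊢ fst v ⦂ τ₁
    snd  : ∀ {m n} {Γ : Ctx m n} {v τ₁ τ₂} → Γ ⊢v v ⦂ τ₁ ⊗ τ₂ → Γ ⊢ snd v ⦂ τ₂
    app  : ∀ {m n} {Γ : Ctx m n} {v e τ₁ τ₂} →
           Γ ⊢v v ⦂ τ₁ ⇒ τ₂ → Γ ⊢ e ⦂ τ₁ → Γ ⊢ app v e ⦂ τ₂
    case : ∀ {m n} {Γ : Ctx m n} {v τs es τ} →
           Γ ⊢v v ⦂ μΣ τs → Branches Γ (μΣ τs) τs es τ → Γ ⊢ case v es ⦂ τ
    tapp : ∀ {m n} {Γ : Ctx m n} {v τ} (σ : Ty m) →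
           Γ ⊢v v ⦂ ∀' τ → Γ ⊢ tapp v σ ⦂ τ [ σ ]ᵗ

  data Branches : ∀ {m n} → Ctx m n → Ty m → List (Ty (suc m)) → List (Tm m (suc n)) → Ty m → Set where
    []  : ∀ {m n} {Γ : Ctx m n} {μ τ} → Branches Γ μ [] [] τ
    _∷_ : ∀ {m n} {Γ : Ctx m n} {μ τ σ σs e es} →
          (σ [ μ ]ᵗ ∷ Γ) ⊢ e ⦂ τ → Branches Γ μ σs es τ → Branches Γ μ (σ ∷ σs) (e ∷ es) τ

infix 4 _↦_

data _↦_ : Tm 0 0 → Tm 0 0 → Set where
  β-fst  : ∀ {a b} → fst (pair a b) ↦ val a
  β-snd  : ∀ {a b} → snd (pair a b) ↦ val b
  β-lam  : ∀ {e v} → app (lam e) (val v) ↦ e [ v ]ᵉ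
  β-tlam : ∀ {e τ} → tapp (tlam e) τ ↦ e [ τ ]ᵀ
  β-case : ∀ {v} (es : List (Tm 0 1)) (j : Fin (length es)) →
           case (inj (toℕ j) v) es ↦ L.lookup es j [ v ]ᵉ
  choice : ∀ (k : ℕ) → ¿ ↦ val (numeral k)
  ξ-app  : ∀ {v e e'} → e ↦ e' → app v e ↦ app v e'

MayDiverge : Tm 0 0 → Set
MayDiverge e = Σ (ℕ → Tm 0 0) λ f → (f 0 ≡ e) × (∀ i → f i ↦ f (suc i))

_⇓ : Tm 0 0 → Set
e ⇓ = ¬ MayDiverge e

TIRel : Set₁
TIRel = ∀ {m n} → Ctx m n → Tm m n → Tm m n → Ty m → Set

data BranchesR (R : TIRel) : ∀ {m n} → Ctx m n → Ty m → List (Ty (suc m)) →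
                 List (Tm m (suc n)) → List (Tm m (suc n)) → Ty m → Set where
  []  : ∀ {m n} {Γ : Ctx m n} {μ τ} → BranchesR R Γ μ [] [] [] τ
  _∷_ : ∀ {m n} {Γ : Ctx m n} {μ τ σ σs e e' es es'} →
        R (σ [ μ ]ᵗ ∷ Γ) e e' τ → BranchesR R Γ μ σs es es' τ →
        BranchesR R Γ μ (σ ∷ σs) (e ∷ es) (e' ∷ es') τ

record IsTypeIndexed (R : TIRel) : Set where
  field
    typed : ∀ {m n} {Γ : Ctx m n} {e e' τ} → R Γ e e' τ → (Γ ⊢ e ⦂ τ) × (Γ ⊢ e' ⦂ τ)

record IsCompatible (R : TIRel) : Set where
  field
    c-var  : ∀ {m n} {Γ : Ctx m n} (x : Fin n) → R Γ (val (var x)) (val (var x)) (lookup Γ x)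
    c-unit : ∀ {m n} {Γ : Ctx m n} → R Γ (val ⟨⟩) (val ⟨⟩) 𝟙
    c-¿    : ∀ {m n} {Γ : Ctx m n} → R Γ ¿ ¿ nat
    c-pair : ∀ {m n} {Γ : Ctx m n} {a a' b b' τ₁ τ₂} →
             R Γ (val a) (val a') τ₁ → R Γ (val b) (val b') τ₂ →
             R Γ (val (pair a b)) (val (pair a' b')) (τ₁ ⊗ τ₂)
    c-lam  : ∀ {m n} {Γ : Ctx m n} {e e' τ₁ τ₂} →
             R (τ₁ ∷ Γ) e e' τ₂ → R Γ (val (lam e)) (val (lam e')) (τ₁ ⇒ τ₂)
    c-inj  : ∀ {m n} {Γ : Ctx m n} {τs v v'} (j : Fin (length τs)) →
             R Γ (val v) (val v') (unfold τs j) →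
             R Γ (val (inj (toℕ j) v)) (val (inj (toℕ j) v')) (μΣ τs)
    c-tlam : ∀ {m n} {Γ : Ctx m n} {e e' τ} →
             R (wkCtx Γ) e e' τ → R Γ (val (tlam e)) (val (tlam e')) (∀' τ)
    c-fst  : ∀ {m n} {Γ : Ctx m n} {v v' τ₁ τ₂} →
             R Γ (val v) (val v') (τ₁ ⊗ τ₂) → R Γ (fst v) (fst v') τ₁
    c-snd  : ∀ {m n} {Γ : Ctx m n} {v v' τ₁ τ₂} →
             R Γ (val v) (val v') (τ₁ ⊗ τ₂) → R Γ (snd v) (snd v') τ₂
    c-app  : ∀ {m n} {Γ : Ctx m n} {v v' e e' τ₁ τ₂} →
             R Γ (val v) (val v') (τ₁ ⇒ τ₂) → R Γ e e' τ₁ → R Γ (app v e) (app v' e') τ₂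
    c-case : ∀ {m n} {Γ : Ctx m n} {v v' τs es es' τ} →
             R Γ (val v) (val v') (μΣ τs) → BranchesR R Γ (μΣ τs) τs es es' τ →
             R Γ (case v es) (case v' es') τ
    c-tapp : ∀ {m n} {Γ : Ctx m n} {v v' τ} (σ : Ty m) →
             R Γ (val v) (val v') (∀' τ) → R Γ (tapp v σ) (tapp v' σ) (τ [ σ ]ᵗ)

record IsMustAdequatePrecongruence (R : TIRel) : Set where
  field
    isTypeIndexed : IsTypeIndexed R
    reflexive     : ∀ {m n} {Γ : Ctx m n} {e τ} → Γ ⊢ e ⦂ τ → R Γ e e τ
    transitive    : ∀ {m n} {Γ : Ctx m n} {e₁ e₂ e₃ τ} →
                    R Γ e₁ e₂ τ → R Γ e₂ e₃ τ → R Γ e₁ e₃ τ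
    compatible    : IsCompatible R
    mustAdequate  : ∀ {e e' : Tm 0 0} {τ} → R [] e e' τ → e ⇓ → e' ⇓

-- Δ;Γ ⊢ e ≲ctx e' : τ  — related by the largest must-adequate precongruence,
-- i.e. by the union of all must-adequate precongruences.
_⊢_≲ctx_⦂_ : ∀ {m n} → Ctx m n → Tm m n → Tm m n → Ty m → Set₁
Γ ⊢ e ≲ctx e' ⦂ τ = Σ TIRel λ R → IsMustAdequatePrecongruence R × R Γ e e' τ

_⊢_≅ctx_⦂_ : ∀ {m n} → Ctx m n → Tm m n → Tm m n → Ty m → Set₁
Γ ⊢ e ≅ctx e' ⦂ τ = (Γ ⊢ e ≲ctx e' ⦂ τ) × (Γ ⊢ e' ≲ctx e ⦂ τ)

-- δ_f = λy. case y of (in y' ⇒ f (λx. (λr. r x) (y' y)))   (f = variable 0)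
δ : ∀ {m n} → Val m (suc n)
δ = lam (case (var zero)
      (app (var (suc (suc zero)))
           (val (lam (app (lam (app (var zero) (val (var (suc zero)))))
                          (app (var (suc zero)) (val (var (suc (suc zero)))))))) ∷ []))

-- fix = Λα.Λβ.λf. δ_f (in δ_f)
fix : ∀ {m n} → Val m n
fix = tlam (val (tlam (val (lam (app δ (val (inj 0 δ)))))))

-- Ω = Λα. fix[1][α] (λf.f) ⟨⟩, the applications abbreviating let-sequences:
-- Λα. (λa. (λb. (λc. c ⟨⟩) (b (λf.f))) (a[α])) (fix[1])
Ω : ∀ {m n} → Val m n
Ω = tlam (app (lam (app (lam (app (lam (app (var zero) (val ⟨⟩)))
                                  (app (var zero) (val (lam (val (var zero)))))))
                        (tapp (var zero) (tv zero))))
              (tapp fix 𝟙))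

PolyPairFun : Ty 0
PolyPairFun = ∀' ((tv zero ⊗ tv zero) ⇒ tv zero)

module Submission where

-- Let w = Λα. Ω[α×α→α].  Both v and w are type abstractions whose
-- instantiation may diverge: v at some τ by hypothesis, w at every type
-- because Ω loops.  Reduction never inspects types, so after erasing types
-- v diverges when instantiated at any type, and we may compare v and w on
-- erased terms.  Write t ⊑ t' when the erased term t arises from t' by
-- replacing some type abstractions with closed type abstractions whose
-- instantiation diverges.  This is a backward simulation for divergence:
-- every step of t' is matched by t, unless t has just instantiated one of
-- the diverging abstractions.  Hence "e, e' typed and erase e ⊑* erase e'"
-- is a must-adequate precongruence; it relates v to w and w to v, and since
-- ≲ctx contains every must-adequate precongruence, v ≅ctx w.

open import Defs
open import Data.Nat using (ℕ; zero; suc)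
open import Data.Fin using (Fin; zero; suc; toℕ)
open import Data.List using (List; []; _∷_; length)
import Data.List as L
open import Data.Maybe using (Maybe; just; nothing)
import Data.Maybe as Maybe
open import Data.Vec using ([]; _∷_)
open import Data.Product using (Σ; ∃; _×_; _,_; proj₁; proj₂)
open import Data.Sum using (_⊎_; inj₁; inj₂)
open import Relation.Binary.PropositionalEquality
  using (_≡_; refl; sym; trans; cong; cong₂; subst)
open import Relation.Binary.Construct.Closure.ReflexiveTransitive
  using (Star; ε; _◅_; _◅◅_; gmap)

Diverges : {A : Set} → (A → A → Set) → A → Set
Diverges {A} _▷_ a = Σ (ℕ → A) λ f → (f 0 ≡ a) × (∀ i → f i ▷ f (suc i))

module _ {A S : Set} (_▷_ : A → A → Set) (at : S → A)
         (next : ∀ s → Σ S λ s' → at s ▷ at s') where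

  private
    states : S → ℕ → S
    states s zero    = s
    states s (suc i) = proj₁ (next (states s i))

  iterate-diverges : (s : S) → Diverges _▷_ (at s)
  iterate-diverges s = (λ i → at (states s i)) , refl , (λ i → proj₂ (next (states s i)))

module _ {A B : Set} {_▷_ : A → A → Set} {_▶_ : B → B → Set}
         (_∼_ : A → B → Set)
         (answer : ∀ {a b b'} → a ∼ b → b ▶ b' →
                   (Σ A λ a' → (a ▷ a') × (a' ∼ b')) ⊎ Diverges _▷_ a) where

  private
    -- Either still following the chain f of b at position i, or already
    -- running along a divergent chain of a at position j.
    data Phase (f : ℕ → B) : Set where
      following : (i : ℕ) (a : A) → a ∼ f i → Phase f
      diverging : (g : ℕ → A) → (∀ j → g j ▷ g (suc j)) → ℕ → Phase f

    at : ∀ {f} → Phase f → A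
    at (following i a _) = a
    at (diverging g _ j) = g j

  diverges-back : ∀ {a b} → a ∼ b → Diverges _▶_ b → Diverges _▷_ a
  diverges-back {a} a∼b (f , f0≡b , steps) =
    iterate-diverges _▷_ at next (following 0 a (subst (a ∼_) (sym f0≡b) a∼b))
    where
      next : ∀ p → Σ (Phase f) λ p' → at p ▷ at p'
      next (following i a a∼fi) with answer a∼fi (steps i)
      ... | inj₁ (a' , a▷a' , a'∼) = following (suc i) a' a'∼ , a▷a'
      ... | inj₂ (g , g0≡a , gsteps) =
        diverging g gsteps 1 , subst (_▷ g 1) g0≡a (gsteps 0)
      next (diverging g gsteps j) = diverging g gsteps (suc j) , gsteps j

-- Erased syntax: types deleted, type abstraction and instantiation kept as
-- markers.  Reduction never depends on types, so it is studied here.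

mutual
  data EV (n : ℕ) : Set where
    Evar  : Fin n → EV n
    Eunit : EV n
    Epair : EV n → EV n → EV n
    Elam  : ET (suc n) → EV n
    Einj  : ℕ → EV n → EV n
    Etlam : ET n → EV n

  data ET (n : ℕ) : Set where
    Eval  : EV n → ET n
    E¿    : ET n
    Efst  : EV n → ET n
    Esnd  : EV n → ET n
    Eapp  : EV n → ET n → ET n
    Ecase : EV n → List (ET (suc n)) → ET n
    Etapp : EV n → ET n

mutual
  erenV : ∀ {n k} → (Fin n → Fin k) → EV n → EV k
  erenV ρ (Evar x)    = Evar (ρ x)
  erenV ρ Eunit       = Eunit
  erenV ρ (Epair a b) = Epair (erenV ρ a) (erenV ρ b)
  erenV ρ (Elam e)    = Elam (erenT (extR ρ) e)
  erenV ρ (Einj i v)  = Einj i (erenV ρ v)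
  erenV ρ (Etlam e)   = Etlam (erenT ρ e)

  erenT : ∀ {n k} → (Fin n → Fin k) → ET n → ET k
  erenT ρ (Eval v)     = Eval (erenV ρ v)
  erenT ρ E¿           = E¿
  erenT ρ (Efst v)     = Efst (erenV ρ v)
  erenT ρ (Esnd v)     = Esnd (erenV ρ v)
  erenT ρ (Eapp v e)   = Eapp (erenV ρ v) (erenT ρ e)
  erenT ρ (Ecase v es) = Ecase (erenV ρ v) (erenTs (extR ρ) es)
  erenT ρ (Etapp v)    = Etapp (erenV ρ v)

  erenTs : ∀ {n k} → (Fin n → Fin k) → List (ET n) → List (ET k)
  erenTs ρ []       = []
  erenTs ρ (e ∷ es) = erenT ρ e ∷ erenTs ρ es

eext : ∀ {n k} → (Fin n → EV k) → Fin (suc n) → EV (suc k)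
eext σ zero    = Evar zero
eext σ (suc i) = erenV suc (σ i)

mutual
  esubV : ∀ {n k} → (Fin n → EV k) → EV n → EV k
  esubV σ (Evar x)    = σ x
  esubV σ Eunit       = Eunit
  esubV σ (Epair a b) = Epair (esubV σ a) (esubV σ b)
  esubV σ (Elam e)    = Elam (esubT (eext σ) e)
  esubV σ (Einj i v)  = Einj i (esubV σ v)
  esubV σ (Etlam e)   = Etlam (esubT σ e)

  esubT : ∀ {n k} → (Fin n → EV k) → ET n → ET k
  esubT σ (Eval v)     = Eval (esubV σ v)
  esubT σ E¿           = E¿
  esubT σ (Efst v)     = Efst (esubV σ v)
  esubT σ (Esnd v)     = Esnd (esubV σ v)
  esubT σ (Eapp v e)   = Eapp (esubV σ v) (esubT σ e)
  esubT σ (Ecase v es) = Ecase (esubV σ v) (esubTs (eext σ) es)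
  esubT σ (Etapp v)    = Etapp (esubV σ v)

  esubTs : ∀ {n k} → (Fin n → EV k) → List (ET n) → List (ET k)
  esubTs σ []       = []
  esubTs σ (e ∷ es) = esubT σ e ∷ esubTs σ es

esingle : ∀ {n} → EV n → Fin (suc n) → EV n
esingle u zero    = u
esingle u (suc i) = Evar i

_⟦_⟧ : ∀ {n} → ET (suc n) → EV n → ET n
e ⟦ u ⟧ = esubT (esingle u) e

extR-∘ : ∀ {n k l} {ρ : Fin k → Fin l} {ρ' : Fin n → Fin k} {ρ'' : Fin n → Fin l} →
  (∀ i → ρ (ρ' i) ≡ ρ'' i) → ∀ i → extR ρ (extR ρ' i) ≡ extR ρ'' i
extR-∘ h zero    = refl
extR-∘ h (suc i) = cong suc (h i)

mutual
  eren-erenV : ∀ {n k l} {ρ : Fin k → Fin l} {ρ' : Fin n → Fin k} {ρ'' : Fin n → Fin l} →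
    (∀ i → ρ (ρ' i) ≡ ρ'' i) → ∀ u → erenV ρ (erenV ρ' u) ≡ erenV ρ'' u
  eren-erenV h (Evar x)    = cong Evar (h x)
  eren-erenV h Eunit       = refl
  eren-erenV h (Epair a b) = cong₂ Epair (eren-erenV h a) (eren-erenV h b)
  eren-erenV h (Elam e)    = cong Elam (eren-erenT (extR-∘ h) e)
  eren-erenV h (Einj i v)  = cong (Einj i) (eren-erenV h v)
  eren-erenV h (Etlam e)   = cong Etlam (eren-erenT h e)

  eren-erenT : ∀ {n k l} {ρ : Fin k → Fin l} {ρ' : Fin n → Fin k} {ρ'' : Fin n → Fin l} →
    (∀ i → ρ (ρ' i) ≡ ρ'' i) → ∀ u → erenT ρ (erenT ρ' u) ≡ erenT ρ'' u
  eren-erenT h (Eval v)     = cong Eval (eren-erenV h v)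
  eren-erenT h E¿           = refl
  eren-erenT h (Efst v)     = cong Efst (eren-erenV h v)
  eren-erenT h (Esnd v)     = cong Esnd (eren-erenV h v)
  eren-erenT h (Eapp v e)   = cong₂ Eapp (eren-erenV h v) (eren-erenT h e)
  eren-erenT h (Ecase v es) = cong₂ Ecase (eren-erenV h v) (eren-erenTs (extR-∘ h) es)
  eren-erenT h (Etapp v)    = cong Etapp (eren-erenV h v)

  eren-erenTs : ∀ {n k l} {ρ : Fin k → Fin l} {ρ' : Fin n → Fin k} {ρ'' : Fin n → Fin l} →
    (∀ i → ρ (ρ' i) ≡ ρ'' i) → ∀ u → erenTs ρ (erenTs ρ' u) ≡ erenTs ρ'' u
  eren-erenTs h []       = refl
  eren-erenTs h (e ∷ es) = cong₂ _∷_ (eren-erenT h e) (eren-erenTs h es)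

extR-id : ∀ {n} {ρ : Fin n → Fin n} → (∀ i → ρ i ≡ i) → ∀ i → extR ρ i ≡ i
extR-id h zero    = refl
extR-id h (suc i) = cong suc (h i)

mutual
  eren-idV : ∀ {n} {ρ : Fin n → Fin n} → (∀ i → ρ i ≡ i) → ∀ u → erenV ρ u ≡ u
  eren-idV h (Evar x)    = cong Evar (h x)
  eren-idV h Eunit       = refl
  eren-idV h (Epair a b) = cong₂ Epair (eren-idV h a) (eren-idV h b)
  eren-idV h (Elam e)    = cong Elam (eren-idT (extR-id h) e)
  eren-idV h (Einj i v)  = cong (Einj i) (eren-idV h v)
  eren-idV h (Etlam e)   = cong Etlam (eren-idT h e)

  eren-idT : ∀ {n} {ρ : Fin n → Fin n} → (∀ i → ρ i ≡ i) → ∀ u → erenT ρ u ≡ u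
  eren-idT h (Eval v)     = cong Eval (eren-idV h v)
  eren-idT h E¿           = refl
  eren-idT h (Efst v)     = cong Efst (eren-idV h v)
  eren-idT h (Esnd v)     = cong Esnd (eren-idV h v)
  eren-idT h (Eapp v e)   = cong₂ Eapp (eren-idV h v) (eren-idT h e)
  eren-idT h (Ecase v es) = cong₂ Ecase (eren-idV h v) (eren-idTs (extR-id h) es)
  eren-idT h (Etapp v)    = cong Etapp (eren-idV h v)

  eren-idTs : ∀ {n} {ρ : Fin n → Fin n} → (∀ i → ρ i ≡ i) → ∀ u → erenTs ρ u ≡ u
  eren-idTs h []       = refl
  eren-idTs h (e ∷ es) = cong₂ _∷_ (eren-idT h e) (eren-idTs h es)

eext-eren : ∀ {n k l} {σ : Fin k → EV l} {ρ : Fin n → Fin k} {σ' : Fin n → EV l} →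
  (∀ i → σ (ρ i) ≡ σ' i) → ∀ i → eext σ (extR ρ i) ≡ eext σ' i
eext-eren h zero    = refl
eext-eren h (suc i) = cong (erenV suc) (h i)

mutual
  esub-erenV : ∀ {n k l} {σ : Fin k → EV l} {ρ : Fin n → Fin k} {σ' : Fin n → EV l} →
    (∀ i → σ (ρ i) ≡ σ' i) → ∀ u → esubV σ (erenV ρ u) ≡ esubV σ' u
  esub-erenV h (Evar x)    = h x
  esub-erenV h Eunit       = refl
  esub-erenV h (Epair a b) = cong₂ Epair (esub-erenV h a) (esub-erenV h b)
  esub-erenV h (Elam e)    = cong Elam (esub-erenT (eext-eren h) e)
  esub-erenV h (Einj i v)  = cong (Einj i) (esub-erenV h v)
  esub-erenV h (Etlam e)   = cong Etlam (esub-erenT h e)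

  esub-erenT : ∀ {n k l} {σ : Fin k → EV l} {ρ : Fin n → Fin k} {σ' : Fin n → EV l} →
    (∀ i → σ (ρ i) ≡ σ' i) → ∀ u → esubT σ (erenT ρ u) ≡ esubT σ' u
  esub-erenT h (Eval v)     = cong Eval (esub-erenV h v)
  esub-erenT h E¿           = refl
  esub-erenT h (Efst v)     = cong Efst (esub-erenV h v)
  esub-erenT h (Esnd v)     = cong Esnd (esub-erenV h v)
  esub-erenT h (Eapp v e)   = cong₂ Eapp (esub-erenV h v) (esub-erenT h e)
  esub-erenT h (Ecase v es) = cong₂ Ecase (esub-erenV h v) (esub-erenTs (eext-eren h) es)
  esub-erenT h (Etapp v)    = cong Etapp (esub-erenV h v)

  esub-erenTs : ∀ {n k l} {σ : Fin k → EV l} {ρ : Fin n → Fin k} {σ' : Fin n → EV l} →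
    (∀ i → σ (ρ i) ≡ σ' i) → ∀ u → esubTs σ (erenTs ρ u) ≡ esubTs σ' u
  esub-erenTs h []       = refl
  esub-erenTs h (e ∷ es) = cong₂ _∷_ (esub-erenT h e) (esub-erenTs h es)

eext-var : ∀ {n k} {σ : Fin n → EV k} {ρ : Fin n → Fin k} →
  (∀ i → σ i ≡ Evar (ρ i)) → ∀ i → eext σ i ≡ Evar (extR ρ i)
eext-var h zero    = refl
eext-var h (suc i) = cong (erenV suc) (h i)

mutual
  esub-varV : ∀ {n k} {σ : Fin n → EV k} {ρ : Fin n → Fin k} →
    (∀ i → σ i ≡ Evar (ρ i)) → ∀ u → esubV σ u ≡ erenV ρ u
  esub-varV h (Evar x)    = h x
  esub-varV h Eunit       = refl
  esub-varV h (Epair a b) = cong₂ Epair (esub-varV h a) (esub-varV h b)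
  esub-varV h (Elam e)    = cong Elam (esub-varT (eext-var h) e)
  esub-varV h (Einj i v)  = cong (Einj i) (esub-varV h v)
  esub-varV h (Etlam e)   = cong Etlam (esub-varT h e)

  esub-varT : ∀ {n k} {σ : Fin n → EV k} {ρ : Fin n → Fin k} →
    (∀ i → σ i ≡ Evar (ρ i)) → ∀ u → esubT σ u ≡ erenT ρ u
  esub-varT h (Eval v)     = cong Eval (esub-varV h v)
  esub-varT h E¿           = refl
  esub-varT h (Efst v)     = cong Efst (esub-varV h v)
  esub-varT h (Esnd v)     = cong Esnd (esub-varV h v)
  esub-varT h (Eapp v e)   = cong₂ Eapp (esub-varV h v) (esub-varT h e)
  esub-varT h (Ecase v es) = cong₂ Ecase (esub-varV h v) (esub-varTs (eext-var h) es)
  esub-varT h (Etapp v)    = cong Etapp (esub-varV h v)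

  esub-varTs : ∀ {n k} {σ : Fin n → EV k} {ρ : Fin n → Fin k} →
    (∀ i → σ i ≡ Evar (ρ i)) → ∀ u → esubTs σ u ≡ erenTs ρ u
  esub-varTs h []       = refl
  esub-varTs h (e ∷ es) = cong₂ _∷_ (esub-varT h e) (esub-varTs h es)

embT : ∀ {n} → ET 0 → ET n
embT = erenT (λ ())

emb-ren : ∀ {n k} (ρ : Fin n → Fin k) (c : ET 0) → erenT ρ (embT c) ≡ embT c
emb-ren ρ = eren-erenT (λ ())

emb-sub : ∀ {n k} (σ : Fin n → EV k) (c : ET 0) → esubT σ (embT c) ≡ embT c
emb-sub σ c = trans (esub-erenT {σ' = λ ()} (λ ()) c) (esub-varT {ρ = λ ()} (λ ()) c)

emb-id : (c : ET 0) → embT c ≡ c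
emb-id = eren-idT (λ ())

mutual
  eraseV : ∀ {m n} → Val m n → EV n
  eraseV (var x)    = Evar x
  eraseV ⟨⟩         = Eunit
  eraseV (pair a b) = Epair (eraseV a) (eraseV b)
  eraseV (lam e)    = Elam (eraseT e)
  eraseV (inj i v)  = Einj i (eraseV v)
  eraseV (tlam e)   = Etlam (eraseT e)

  eraseT : ∀ {m n} → Tm m n → ET n
  eraseT (val v)     = Eval (eraseV v)
  eraseT ¿           = E¿
  eraseT (fst v)     = Efst (eraseV v)
  eraseT (snd v)     = Esnd (eraseV v)
  eraseT (app v e)   = Eapp (eraseV v) (eraseT e)
  eraseT (case v es) = Ecase (eraseV v) (eraseTs es)
  eraseT (tapp v τ)  = Etapp (eraseV v)

  eraseTs : ∀ {m n} → List (Tm m n) → List (ET n)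
  eraseTs []       = []
  eraseTs (e ∷ es) = eraseT e ∷ eraseTs es

mutual
  erase-tsubV : ∀ {m k n} (σ : Fin m → Ty k) (u : Val m n) → eraseV (tsubV σ u) ≡ eraseV u
  erase-tsubV σ (var x)    = refl
  erase-tsubV σ ⟨⟩         = refl
  erase-tsubV σ (pair a b) = cong₂ Epair (erase-tsubV σ a) (erase-tsubV σ b)
  erase-tsubV σ (lam e)    = cong Elam (erase-tsubT σ e)
  erase-tsubV σ (inj i v)  = cong (Einj i) (erase-tsubV σ v)
  erase-tsubV σ (tlam e)   = cong Etlam (erase-tsubT (extS σ) e)

  erase-tsubT : ∀ {m k n} (σ : Fin m → Ty k) (u : Tm m n) → eraseT (tsubT σ u) ≡ eraseT u
  erase-tsubT σ (val v)     = cong Eval (erase-tsubV σ v)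
  erase-tsubT σ ¿           = refl
  erase-tsubT σ (fst v)     = cong Efst (erase-tsubV σ v)
  erase-tsubT σ (snd v)     = cong Esnd (erase-tsubV σ v)
  erase-tsubT σ (app v e)   = cong₂ Eapp (erase-tsubV σ v) (erase-tsubT σ e)
  erase-tsubT σ (case v es) = cong₂ Ecase (erase-tsubV σ v) (erase-tsubTs σ es)
  erase-tsubT σ (tapp v τ)  = cong Etapp (erase-tsubV σ v)

  erase-tsubTs : ∀ {m k n} (σ : Fin m → Ty k) (u : List (Tm m n)) →
    eraseTs (tsubTs σ u) ≡ eraseTs u
  erase-tsubTs σ []       = refl
  erase-tsubTs σ (e ∷ es) = cong₂ _∷_ (erase-tsubT σ e) (erase-tsubTs σ es)

mutual
  erase-trenV : ∀ {m k n} (ρ : Fin m → Fin k) (u : Val m n) → eraseV (trenV ρ u) ≡ eraseV u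
  erase-trenV ρ (var x)    = refl
  erase-trenV ρ ⟨⟩         = refl
  erase-trenV ρ (pair a b) = cong₂ Epair (erase-trenV ρ a) (erase-trenV ρ b)
  erase-trenV ρ (lam e)    = cong Elam (erase-trenT ρ e)
  erase-trenV ρ (inj i v)  = cong (Einj i) (erase-trenV ρ v)
  erase-trenV ρ (tlam e)   = cong Etlam (erase-trenT (extR ρ) e)

  erase-trenT : ∀ {m k n} (ρ : Fin m → Fin k) (u : Tm m n) → eraseT (trenT ρ u) ≡ eraseT u
  erase-trenT ρ (val v)     = cong Eval (erase-trenV ρ v)
  erase-trenT ρ ¿           = refl
  erase-trenT ρ (fst v)     = cong Efst (erase-trenV ρ v)
  erase-trenT ρ (snd v)     = cong Esnd (erase-trenV ρ v)
  erase-trenT ρ (app v e)   = cong₂ Eapp (erase-trenV ρ v) (erase-trenT ρ e)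
  erase-trenT ρ (case v es) = cong₂ Ecase (erase-trenV ρ v) (erase-trenTs ρ es)
  erase-trenT ρ (tapp v τ)  = cong Etapp (erase-trenV ρ v)

  erase-trenTs : ∀ {m k n} (ρ : Fin m → Fin k) (u : List (Tm m n)) →
    eraseTs (trenTs ρ u) ≡ eraseTs u
  erase-trenTs ρ []       = refl
  erase-trenTs ρ (e ∷ es) = cong₂ _∷_ (erase-trenT ρ e) (erase-trenTs ρ es)

mutual
  erase-renV : ∀ {m n k} (ρ : Fin n → Fin k) (u : Val m n) →
    eraseV (renV ρ u) ≡ erenV ρ (eraseV u)
  erase-renV ρ (var x)    = refl
  erase-renV ρ ⟨⟩         = refl
  erase-renV ρ (pair a b) = cong₂ Epair (erase-renV ρ a) (erase-renV ρ b)
  erase-renV ρ (lam e)    = cong Elam (erase-renT (extR ρ) e)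
  erase-renV ρ (inj i v)  = cong (Einj i) (erase-renV ρ v)
  erase-renV ρ (tlam e)   = cong Etlam (erase-renT ρ e)

  erase-renT : ∀ {m n k} (ρ : Fin n → Fin k) (u : Tm m n) →
    eraseT (renT ρ u) ≡ erenT ρ (eraseT u)
  erase-renT ρ (val v)     = cong Eval (erase-renV ρ v)
  erase-renT ρ ¿           = refl
  erase-renT ρ (fst v)     = cong Efst (erase-renV ρ v)
  erase-renT ρ (snd v)     = cong Esnd (erase-renV ρ v)
  erase-renT ρ (app v e)   = cong₂ Eapp (erase-renV ρ v) (erase-renT ρ e)
  erase-renT ρ (case v es) = cong₂ Ecase (erase-renV ρ v) (erase-renTs (extR ρ) es)
  erase-renT ρ (tapp v τ)  = cong Etapp (erase-renV ρ v)

  erase-renTs : ∀ {m n k} (ρ : Fin n → Fin k) (u : List (Tm m n)) →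
    eraseTs (renTs ρ u) ≡ erenTs ρ (eraseTs u)
  erase-renTs ρ []       = refl
  erase-renTs ρ (e ∷ es) = cong₂ _∷_ (erase-renT ρ e) (erase-renTs ρ es)

ErasesTo : ∀ {m n k} → (Fin n → Val m k) → (Fin n → EV k) → Set
ErasesTo σ σ' = ∀ i → σ' i ≡ eraseV (σ i)

extV-erases : ∀ {m n k} {σ : Fin n → Val m k} {σ' : Fin n → EV k} →
  ErasesTo σ σ' → ErasesTo (extV σ) (eext σ')
extV-erases h zero = refl
extV-erases {σ = σ} h (suc i) = trans (cong (erenV suc) (h i)) (sym (erase-renV suc (σ i)))

textV-erases : ∀ {m n k} {σ : Fin n → Val m k} {σ' : Fin n → EV k} →
  ErasesTo σ σ' → ErasesTo (textV σ) σ'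
textV-erases {σ = σ} h i = trans (h i) (sym (erase-trenV suc (σ i)))

mutual
  erase-substV : ∀ {m n k} {σ : Fin n → Val m k} {σ' : Fin n → EV k} → ErasesTo σ σ' →
    (u : Val m n) → eraseV (substV σ u) ≡ esubV σ' (eraseV u)
  erase-substV h (var x)    = sym (h x)
  erase-substV h ⟨⟩         = refl
  erase-substV h (pair a b) = cong₂ Epair (erase-substV h a) (erase-substV h b)
  erase-substV h (lam e)    = cong Elam (erase-substT (extV-erases h) e)
  erase-substV h (inj i v)  = cong (Einj i) (erase-substV h v)
  erase-substV h (tlam e)   = cong Etlam (erase-substT (textV-erases h) e)

  erase-substT : ∀ {m n k} {σ : Fin n → Val m k} {σ' : Fin n → EV k} → ErasesTo σ σ' →
    (u : Tm m n) → eraseT (substT σ u) ≡ esubT σ' (eraseT u)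
  erase-substT h (val v)     = cong Eval (erase-substV h v)
  erase-substT h ¿           = refl
  erase-substT h (fst v)     = cong Efst (erase-substV h v)
  erase-substT h (snd v)     = cong Esnd (erase-substV h v)
  erase-substT h (app v e)   = cong₂ Eapp (erase-substV h v) (erase-substT h e)
  erase-substT h (case v es) = cong₂ Ecase (erase-substV h v) (erase-substTs (extV-erases h) es)
  erase-substT h (tapp v τ)  = cong Etapp (erase-substV h v)

  erase-substTs : ∀ {m n k} {σ : Fin n → Val m k} {σ' : Fin n → EV k} → ErasesTo σ σ' →
    (u : List (Tm m n)) → eraseTs (substTs σ u) ≡ esubTs σ' (eraseTs u)
  erase-substTs h []       = refl
  erase-substTs h (e ∷ es) = cong₂ _∷_ (erase-substT h e) (erase-substTs h es)

erase-β : ∀ {m n} (e : Tm m (suc n)) (v : Val m n) → eraseT (e [ v ]ᵉ) ≡ eraseT e ⟦ eraseV v ⟧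
erase-β e v = erase-substT single-erases e
  where
    single-erases : ErasesTo (singleV v) (esingle (eraseV v))
    single-erases zero    = refl
    single-erases (suc i) = refl

enum : ∀ {n} → ℕ → EV n
enum zero    = Einj 0 Eunit
enum (suc k) = Einj 1 (enum k)

data At {n : ℕ} : List (ET n) → ℕ → ET n → Set where
  here  : ∀ {e es} → At (e ∷ es) 0 e
  there : ∀ {e e' es k} → At es k e → At (e' ∷ es) (suc k) e

infix 4 _⟶_

data _⟶_ : ET 0 → ET 0 → Set where
  β-fst  : ∀ {a b} → Efst (Epair a b) ⟶ Eval a
  β-snd  : ∀ {a b} → Esnd (Epair a b) ⟶ Eval b
  β-lam  : ∀ {e u} → Eapp (Elam e) (Eval u) ⟶ e ⟦ u ⟧
  β-tlam : ∀ {e} → Etapp (Etlam e) ⟶ e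
  β-case : ∀ {es k e u} → At es k e → Ecase (Einj k u) es ⟶ e ⟦ u ⟧
  choice : ∀ k → E¿ ⟶ Eval (enum k)
  ξ-app  : ∀ {u e e'} → e ⟶ e' → Eapp u e ⟶ Eapp u e'

EDiverges : ET 0 → Set
EDiverges = Diverges _⟶_

app-diverges : ∀ {u e} → EDiverges e → EDiverges (Eapp u e)
app-diverges {u} (f , f0≡e , steps) = (λ i → Eapp u (f i)) , cong (Eapp u) f0≡e , (λ i → ξ-app (steps i))

erase-numeral : ∀ {m n} k → eraseV {m} {n} (numeral k) ≡ enum k
erase-numeral zero    = refl
erase-numeral (suc k) = cong (Einj 1) (erase-numeral k)

erase-lookup : ∀ {n m} (es : List (Tm m n)) (j : Fin (length es)) →
  At (eraseTs es) (toℕ j) (eraseT (L.lookup es j))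
erase-lookup (e ∷ es) zero    = here
erase-lookup (e ∷ es) (suc j) = there (erase-lookup es j)

erase-step : ∀ {e e'} → e ↦ e' → eraseT e ⟶ eraseT e'
erase-step β-fst = β-fst
erase-step β-snd = β-snd
erase-step (β-lam {e} {v}) = subst (Eapp (Elam (eraseT e)) (Eval (eraseV v)) ⟶_) (sym (erase-β e v)) β-lam
erase-step (β-tlam {e} {τ}) = subst (Etapp (Etlam (eraseT e)) ⟶_) (sym (erase-tsubT (single τ) e)) β-tlam
erase-step (β-case {v} es j) =
  subst (Ecase (Einj (toℕ j) (eraseV v)) (eraseTs es) ⟶_) (sym (erase-β (L.lookup es j) v)) (β-case (erase-lookup es j))
erase-step (choice k) = subst (λ x → E¿ ⟶ Eval x) (sym (erase-numeral k)) (choice k)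
erase-step (ξ-app s) = ξ-app (erase-step s)

unerase-lookup : ∀ {m n} (es : List (Tm m n)) {k e} → At (eraseTs es) k e →
  Σ (Fin (length es)) λ j → (toℕ j ≡ k) × (eraseT (L.lookup es j) ≡ e)
unerase-lookup (e ∷ es) here = zero , refl , refl
unerase-lookup (e ∷ es) (there l) with unerase-lookup es l
... | j , j≡k , lookup≡e = suc j , cong suc j≡k , lookup≡e

unerase-step : (e : Tm 0 0) {t : ET 0} → eraseT e ⟶ t →
  Σ (Tm 0 0) λ e' → (e ↦ e') × (eraseT e' ≡ t)
unerase-step (fst (pair a b)) β-fst = val a , β-fst , refl
unerase-step (snd (pair a b)) β-snd = val b , β-snd , refl
unerase-step (app (lam b) (val u)) β-lam = b [ u ]ᵉ , β-lam , erase-β b u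
unerase-step (app v e) (ξ-app s) with unerase-step e s
... | e' , e↦e' , erased = app v e' , ξ-app e↦e' , cong (Eapp (eraseV v)) erased
unerase-step (tapp (tlam b) τ) β-tlam = b [ τ ]ᵀ , β-tlam , erase-tsubT (single τ) b
unerase-step (case (inj k u) es) (β-case l) with unerase-lookup es l
... | j , refl , lookup≡e =
  L.lookup es j [ u ]ᵉ , β-case es j , trans (erase-β (L.lookup es j) u) (cong (_⟦ eraseV u ⟧) lookup≡e)
unerase-step ¿ (choice k) = val (numeral k) , choice k , cong Eval (erase-numeral k)

erase-diverges : ∀ {e} → MayDiverge e → EDiverges (eraseT e)
erase-diverges (f , f0≡e , steps) = (λ i → eraseT (f i)) , cong eraseT f0≡e , (λ i → erase-step (steps i))

unerase-diverges : ∀ {e} → EDiverges (eraseT e) → MayDiverge e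
unerase-diverges = diverges-back (λ e t → eraseT e ≡ t) answer refl
  where
    answer : ∀ {e t t'} → eraseT e ≡ t → t ⟶ t' →
      (Σ (Tm 0 0) λ e' → (e ↦ e') × (eraseT e' ≡ t')) ⊎ MayDiverge e
    answer {e} refl s = inj₁ (unerase-step e s)

infix 4 _⊑v_ _⊑_ _⊑s_

mutual
  data _⊑v_ {n : ℕ} : EV n → EV n → Set where
    var       : ∀ x → Evar x ⊑v Evar x
    unit      : Eunit ⊑v Eunit
    pair      : ∀ {a a' b b'} → a ⊑v a' → b ⊑v b' → Epair a b ⊑v Epair a' b'
    lam       : ∀ {e e'} → e ⊑ e' → Elam e ⊑v Elam e'
    inj       : ∀ {k u u'} → u ⊑v u' → Einj k u ⊑v Einj k u'
    tlam      : ∀ {e e'} → e ⊑ e' → Etlam e ⊑v Etlam e'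
    diverging : ∀ {c e'} → EDiverges (Etapp (Etlam c)) → Etlam (embT c) ⊑v Etlam e'

  data _⊑_ {n : ℕ} : ET n → ET n → Set where
    val  : ∀ {u u'} → u ⊑v u' → Eval u ⊑ Eval u'
    ¿    : E¿ ⊑ E¿
    fst  : ∀ {u u'} → u ⊑v u' → Efst u ⊑ Efst u'
    snd  : ∀ {u u'} → u ⊑v u' → Esnd u ⊑ Esnd u'
    app  : ∀ {u u' e e'} → u ⊑v u' → e ⊑ e' → Eapp u e ⊑ Eapp u' e'
    case : ∀ {u u' es es'} → u ⊑v u' → es ⊑s es' → Ecase u es ⊑ Ecase u' es'
    tapp : ∀ {u u'} → u ⊑v u' → Etapp u ⊑ Etapp u'

  data _⊑s_ {n : ℕ} : List (ET n) → List (ET n) → Set where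
    []  : [] ⊑s []
    _∷_ : ∀ {e e' es es'} → e ⊑ e' → es ⊑s es' → (e ∷ es) ⊑s (e' ∷ es')

diverging₀ : ∀ {c e'} → EDiverges (Etapp (Etlam c)) → Etlam c ⊑v Etlam e'
diverging₀ {c} d = subst (λ x → Etlam x ⊑v _) (emb-id c) (diverging d)

mutual
  ⊑v-refl : ∀ {n} (u : EV n) → u ⊑v u
  ⊑v-refl (Evar x)    = var x
  ⊑v-refl Eunit       = unit
  ⊑v-refl (Epair a b) = pair (⊑v-refl a) (⊑v-refl b)
  ⊑v-refl (Elam e)    = lam (⊑-refl e)
  ⊑v-refl (Einj i v)  = inj (⊑v-refl v)
  ⊑v-refl (Etlam e)   = tlam (⊑-refl e)

  ⊑-refl : ∀ {n} (e : ET n) → e ⊑ e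
  ⊑-refl (Eval v)     = val (⊑v-refl v)
  ⊑-refl E¿           = ¿
  ⊑-refl (Efst v)     = fst (⊑v-refl v)
  ⊑-refl (Esnd v)     = snd (⊑v-refl v)
  ⊑-refl (Eapp v e)   = app (⊑v-refl v) (⊑-refl e)
  ⊑-refl (Ecase v es) = case (⊑v-refl v) (⊑s-refl es)
  ⊑-refl (Etapp v)    = tapp (⊑v-refl v)

  ⊑s-refl : ∀ {n} (es : List (ET n)) → es ⊑s es
  ⊑s-refl []       = []
  ⊑s-refl (e ∷ es) = ⊑-refl e ∷ ⊑s-refl es

mutual
  ⊑v-ren : ∀ {n k} (ρ : Fin n → Fin k) {u u' : EV n} → u ⊑v u' → erenV ρ u ⊑v erenV ρ u'
  ⊑v-ren ρ (var x)       = var (ρ x)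
  ⊑v-ren ρ unit          = unit
  ⊑v-ren ρ (pair a b)    = pair (⊑v-ren ρ a) (⊑v-ren ρ b)
  ⊑v-ren ρ (lam e)       = lam (⊑-ren (extR ρ) e)
  ⊑v-ren ρ (inj v)       = inj (⊑v-ren ρ v)
  ⊑v-ren ρ (tlam e)      = tlam (⊑-ren ρ e)
  ⊑v-ren ρ (diverging {c} d) = subst (λ x → Etlam x ⊑v _) (sym (emb-ren ρ c)) (diverging d)

  ⊑-ren : ∀ {n k} (ρ : Fin n → Fin k) {e e' : ET n} → e ⊑ e' → erenT ρ e ⊑ erenT ρ e'
  ⊑-ren ρ (val v)     = val (⊑v-ren ρ v)
  ⊑-ren ρ ¿           = ¿
  ⊑-ren ρ (fst v)     = fst (⊑v-ren ρ v)
  ⊑-ren ρ (snd v)     = snd (⊑v-ren ρ v)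
  ⊑-ren ρ (app v e)   = app (⊑v-ren ρ v) (⊑-ren ρ e)
  ⊑-ren ρ (case v es) = case (⊑v-ren ρ v) (⊑s-ren (extR ρ) es)
  ⊑-ren ρ (tapp v)    = tapp (⊑v-ren ρ v)

  ⊑s-ren : ∀ {n k} (ρ : Fin n → Fin k) {es es' : List (ET n)} → es ⊑s es' →
    erenTs ρ es ⊑s erenTs ρ es'
  ⊑s-ren ρ []       = []
  ⊑s-ren ρ (e ∷ es) = ⊑-ren ρ e ∷ ⊑s-ren ρ es

_⊑σ_ : ∀ {n k} → (Fin n → EV k) → (Fin n → EV k) → Set
σ ⊑σ σ' = ∀ i → σ i ⊑v σ' i

eext-⊑ : ∀ {n k} {σ σ' : Fin n → EV k} → σ ⊑σ σ' → eext σ ⊑σ eext σ'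
eext-⊑ h zero    = var zero
eext-⊑ h (suc i) = ⊑v-ren suc (h i)

mutual
  ⊑v-sub : ∀ {n k} {σ σ' : Fin n → EV k} → σ ⊑σ σ' →
    {u u' : EV n} → u ⊑v u' → esubV σ u ⊑v esubV σ' u'
  ⊑v-sub h (var x)    = h x
  ⊑v-sub h unit       = unit
  ⊑v-sub h (pair a b) = pair (⊑v-sub h a) (⊑v-sub h b)
  ⊑v-sub h (lam e)    = lam (⊑-sub (eext-⊑ h) e)
  ⊑v-sub h (inj v)    = inj (⊑v-sub h v)
  ⊑v-sub h (tlam e)   = tlam (⊑-sub h e)
  ⊑v-sub {σ = σ} h (diverging {c} d) =
    subst (λ x → Etlam x ⊑v _) (sym (emb-sub σ c)) (diverging d)

  ⊑-sub : ∀ {n k} {σ σ' : Fin n → EV k} → σ ⊑σ σ' →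
    {e e' : ET n} → e ⊑ e' → esubT σ e ⊑ esubT σ' e'
  ⊑-sub h (val v)     = val (⊑v-sub h v)
  ⊑-sub h ¿           = ¿
  ⊑-sub h (fst v)     = fst (⊑v-sub h v)
  ⊑-sub h (snd v)     = snd (⊑v-sub h v)
  ⊑-sub h (app v e)   = app (⊑v-sub h v) (⊑-sub h e)
  ⊑-sub h (case v es) = case (⊑v-sub h v) (⊑s-sub (eext-⊑ h) es)
  ⊑-sub h (tapp v)    = tapp (⊑v-sub h v)

  ⊑s-sub : ∀ {n k} {σ σ' : Fin n → EV k} → σ ⊑σ σ' →
    {es es' : List (ET n)} → es ⊑s es' → esubTs σ es ⊑s esubTs σ' es'
  ⊑s-sub h []       = []
  ⊑s-sub h (e ∷ es) = ⊑-sub h e ∷ ⊑s-sub h es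

⊑-β : ∀ {n} {e e' : ET (suc n)} {u u' : EV n} → e ⊑ e' → u ⊑v u' → e ⟦ u ⟧ ⊑ e' ⟦ u' ⟧
⊑-β e⊑e' u⊑u' = ⊑-sub single-⊑ e⊑e'
  where
    single-⊑ : esingle _ ⊑σ esingle _
    single-⊑ zero    = u⊑u'
    single-⊑ (suc i) = var i

⊑s-at : ∀ {n} {es es' : List (ET n)} {k e'} → es ⊑s es' → At es' k e' →
  Σ (ET n) λ e → At es k e × e ⊑ e'
⊑s-at (e⊑e' ∷ _) here = _ , here , e⊑e'
⊑s-at (_ ∷ es⊑es') (there l) with ⊑s-at es⊑es' l
... | e , l' , e⊑e' = e , there l' , e⊑e'

⊑-simulates : ∀ {t t' t'₁} → t ⊑ t' → t' ⟶ t'₁ →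
  (Σ (ET 0) λ t₁ → (t ⟶ t₁) × (t₁ ⊑ t'₁)) ⊎ EDiverges t
⊑-simulates (fst (pair a _)) β-fst = inj₁ (_ , β-fst , val a)
⊑-simulates (snd (pair _ b)) β-snd = inj₁ (_ , β-snd , val b)
⊑-simulates (app (lam e) (val u)) β-lam = inj₁ (_ , β-lam , ⊑-β e u)
⊑-simulates (tapp (tlam e)) β-tlam = inj₁ (_ , β-tlam , e)
⊑-simulates (tapp (diverging {c} d)) β-tlam =
  inj₂ (subst (λ x → EDiverges (Etapp (Etlam x))) (sym (emb-id c)) d)
⊑-simulates (case (inj u) es) (β-case l) with ⊑s-at es l
... | _ , l' , e = inj₁ (_ , β-case l' , ⊑-β e u)
⊑-simulates ¿ (choice k) = inj₁ (_ , choice k , ⊑-refl _)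
⊑-simulates (app u e) (ξ-app s) with ⊑-simulates e s
... | inj₁ (_ , s' , e₁) = inj₁ (_ , ξ-app s' , app u e₁)
... | inj₂ d = inj₂ (app-diverges d)

⊑*-diverges : ∀ {t t'} → Star _⊑_ t t' → EDiverges t' → EDiverges t
⊑*-diverges ε d = d
⊑*-diverges (t⊑ ◅ rest) d = diverges-back _⊑_ ⊑-simulates t⊑ (⊑*-diverges rest d)

w : Val 0 0
w = tlam (tapp Ω ((tv zero ⊗ tv zero) ⇒ tv zero))

-- A one-step evaluator for erased terms (¿ aside), used only to write down
-- the reducts of w's instantiation.
nth : ∀ {n} → List (ET n) → ℕ → Maybe (ET n)
nth []       k       = nothing
nth (e ∷ es) zero    = just e
nth (e ∷ es) (suc k) = nth es k

eval-step : ET 0 → Maybe (ET 0)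
eval-step (Efst (Epair a b))        = just (Eval a)
eval-step (Esnd (Epair a b))        = just (Eval b)
eval-step (Eapp (Elam e) (Eval u))  = just (e ⟦ u ⟧)
eval-step (Eapp u (Eval _))         = nothing
eval-step (Eapp u e)                = Maybe.map (Eapp u) (eval-step e)
eval-step (Etapp (Etlam e))         = just e
eval-step (Ecase (Einj k u) es)     = Maybe.map (_⟦ u ⟧) (nth es k)
eval-step _                         = nothing

eval : ℕ → ET 0 → ET 0
eval zero    t = t
eval (suc n) t = Maybe.maybe (eval n) t (eval-step t)

-- The reduction of the erased w[τ] runs 11 steps into a cycle of length 5
-- (Ω's fixed-point combinator unfolding itself).
data Position : Set where
  p0 p1 p2 p3 p4 p5 p6 p7 p8 p9 p10 p11 p12 p13 p14 p15 : Position

reduct : Position → ET 0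
reduct p = eval (index p) (Etapp (eraseV w))
  where
    index : Position → ℕ
    index p0 = 0
    index p1 = 1
    index p2 = 2
    index p3 = 3
    index p4 = 4
    index p5 = 5
    index p6 = 6
    index p7 = 7
    index p8 = 8
    index p9 = 9
    index p10 = 10
    index p11 = 11
    index p12 = 12
    index p13 = 13
    index p14 = 14
    index p15 = 15

reduct-step : ∀ p → Σ Position λ p' → reduct p ⟶ reduct p'
reduct-step p0  = p1  , β-tlam
reduct-step p1  = p2  , β-tlam
reduct-step p2  = p3  , ξ-app β-tlam
reduct-step p3  = p4  , β-lam
reduct-step p4  = p5  , ξ-app β-tlam
reduct-step p5  = p6  , β-lam
reduct-step p6  = p7  , ξ-app β-lam
reduct-step p7  = p8  , ξ-app β-lam
reduct-step p8  = p9  , ξ-app (β-case here)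
reduct-step p9  = p10 , ξ-app β-lam
reduct-step p10 = p11 , β-lam
reduct-step p11 = p12 , β-lam
reduct-step p12 = p13 , ξ-app β-lam
reduct-step p13 = p14 , ξ-app (β-case here)
reduct-step p14 = p15 , ξ-app β-lam
reduct-step p15 = p11 , β-lam

w-diverges : EDiverges (Etapp (eraseV w))
w-diverges = iterate-diverges _⟶_ reduct reduct-step p0

δ-typed : ∀ {m} → let α = tv {suc (suc m)} (suc zero) ; β = tv zero in
  (((α ⇒ β) ⇒ (α ⇒ β)) ∷ []) ⊢v δ ⦂ μΣ ((tv zero ⇒ (tv (suc (suc zero)) ⇒ tv (suc zero))) ∷ []) ⇒ (α ⇒ β)
δ-typed = lam (case (var zero)
  (app (var (suc (suc zero)))
     (val (lam (app (lam (app (var zero) (val (var (suc zero)))))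
                    (app (var (suc zero)) (val (var (suc (suc zero)))))))) ∷ []))

fix-typed : ∀ {m} → [] ⊢v fix {m} {0} ⦂
  ∀' (∀' (((tv (suc zero) ⇒ tv zero) ⇒ (tv (suc zero) ⇒ tv zero)) ⇒ (tv (suc zero) ⇒ tv zero)))
fix-typed = tlam (val (tlam (val (lam (app δ-typed (val (inj zero δ-typed)))))))

Ω-typed : [] ⊢v Ω {1} {0} ⦂ ∀' (tv zero)
Ω-typed = tlam (app (lam (app (lam (app (lam (app (var zero) (val unit)))
                                       (app (var zero) (val (lam (val (var zero)))))))
                             (tapp (tv zero) (var zero))))
                    (tapp 𝟙 fix-typed))

w-typed : [] ⊢v w ⦂ PolyPairFun
w-typed = tlam (tapp _ Ω-typed)

_≼_ : TIRel
_≼_ Γ e e' τ = (Γ ⊢ e ⦂ τ) × (Γ ⊢ e' ⦂ τ) × Star _⊑_ (eraseT e) (eraseT e')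

star-cong₂ : {A B C : Set} {R : A → A → Set} {S : B → B → Set} {T : C → C → Set}
  (f : A → B → C) → (∀ b {a a'} → R a a' → T (f a b) (f a' b)) →
  (∀ a {b b'} → S b b' → T (f a b) (f a b')) →
  ∀ {a a' b b'} → Star R a a' → Star S b b' → Star T (f a b) (f a' b')
star-cong₂ f left right {a' = a'} {b = b} ra sb = gmap (λ x → f x b) (left b) ra ◅◅ gmap (f a') (right a') sb

unval* : ∀ {n} {a b : EV n} → Star _⊑_ (Eval a) (Eval b) → Star _⊑v_ a b
unval* ε              = ε
unval* (val s ◅ rest) = s ◅ unval* rest

unval-typed : ∀ {m n} {Γ : Ctx m n} {v τ} → Γ ⊢ val v ⦂ τ → Γ ⊢v v ⦂ τ
unval-typed (val t) = t

branches-≼ : ∀ {m n} {Γ : Ctx m n} {μ τs es es' τ} → BranchesR _≼_ Γ μ τs es es' τ →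
  Branches Γ μ τs es τ × Branches Γ μ τs es' τ × Star _⊑s_ (eraseTs es) (eraseTs es')
branches-≼ [] = [] , [] , ε
branches-≼ ((t , t' , r) ∷ rs) with branches-≼ rs
... | bs , bs' , r' =
  t ∷ bs , t' ∷ bs' , star-cong₂ _∷_ (λ es s → s ∷ ⊑s-refl es) (λ e s → ⊑-refl e ∷ s) r r'

≼-compatible : IsCompatible _≼_
≼-compatible = record
  { c-var  = λ x → val (var x) , val (var x) , ε
  ; c-unit = val unit , val unit , ε
  ; c-¿    = ¿ , ¿ , ε
  ; c-pair = λ (ta , ta' , ra) (tb , tb' , rb) →
      val (pair (unval-typed ta) (unval-typed tb)) , val (pair (unval-typed ta') (unval-typed tb')) ,
      star-cong₂ (λ x y → Eval (Epair x y)) (λ b s → val (pair s (⊑v-refl b)))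
                 (λ a s → val (pair (⊑v-refl a) s)) (unval* ra) (unval* rb)
  ; c-lam  = λ (t , t' , r) → val (lam t) , val (lam t') , gmap (λ x → Eval (Elam x)) (λ s → val (lam s)) r
  ; c-inj  = λ j (t , t' , r) → val (inj j (unval-typed t)) , val (inj j (unval-typed t')) ,
      gmap (λ x → Eval (Einj (toℕ j) x)) (λ s → val (inj s)) (unval* r)
  ; c-tlam = λ (t , t' , r) → val (tlam t) , val (tlam t') , gmap (λ x → Eval (Etlam x)) (λ s → val (tlam s)) r
  ; c-fst  = λ (t , t' , r) → fst (unval-typed t) , fst (unval-typed t') , gmap Efst fst (unval* r)
  ; c-snd  = λ (t , t' , r) → snd (unval-typed t) , snd (unval-typed t') , gmap Esnd snd (unval* r)
  ; c-app  = λ (t , t' , r) (u , u' , q) → app (unval-typed t) u , app (unval-typed t') u' ,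
      star-cong₂ Eapp (λ e s → app s (⊑-refl e)) (λ a s → app (⊑v-refl a) s) (unval* r) q
  ; c-case = λ (t , t' , r) bs → let (ts , ts' , q) = branches-≼ bs in
      case (unval-typed t) ts , case (unval-typed t') ts' ,
      star-cong₂ Ecase (λ es s → case s (⊑s-refl es)) (λ a s → case (⊑v-refl a) s) (unval* r) q
  ; c-tapp = λ σ (t , t' , r) → tapp σ (unval-typed t) , tapp σ (unval-typed t') , gmap Etapp tapp (unval* r)
  }

-- Must-adequacy is the transport of divergence along erasure and ⊑*.
≼-precongruence : IsMustAdequatePrecongruence _≼_
≼-precongruence = record
  { isTypeIndexed = record { typed = λ (t , t' , _) → t , t' }
  ; reflexive     = λ t → t , t , ε
  ; transitive    = λ (t₁ , _ , r₁₂) (_ , t₃ , r₂₃) → t₁ , t₃ , (r₁₂ ◅◅ r₂₃)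
  ; compatible    = ≼-compatible
  ; mustAdequate  = λ (_ , _ , r) e⇓ e'-diverges →
      e⇓ (unerase-diverges (⊑*-diverges r (erase-diverges e'-diverges)))
  }

instantiable-is-tlam : ∀ {v : Val 0 0} {τ} → MayDiverge (tapp v τ) → Σ (Tm 1 0) λ b → v ≡ tlam b
instantiable-is-tlam (f , f0≡vτ , steps) = is-tlam (subst (_↦ f 1) f0≡vτ (steps 0))
  where
    is-tlam : ∀ {v : Val 0 0} {τ e'} → tapp v τ ↦ e' → Σ (Tm 1 0) λ b → v ≡ tlam b
    is-tlam (β-tlam {b}) = b , refl

-- v = Λ.b with b diverging (after erasure), and w's body diverges; each is
-- therefore ⊑ the other in one step, so ≼ relates them both ways.
lemma6p2 : (v : Val 0 0) → [] ⊢v v ⦂ PolyPairFun →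
    (∃ λ (τ : Ty 0) → MayDiverge (tapp v τ)) →
    [] ⊢ val v ≅ctx val (tlam (tapp Ω ((tv zero ⊗ tv zero) ⇒ tv zero))) ⦂ PolyPairFun
lemma6p2 v v-typed (τ , vτ-diverges) with instantiable-is-tlam vτ-diverges
... | b , refl =
  (_≼_ , ≼-precongruence , val v-typed , val w-typed , v⊑w ◅ ε) ,
  (_≼_ , ≼-precongruence , val w-typed , val v-typed , w⊑v ◅ ε)
  where
    v⊑w : eraseT (val v) ⊑ eraseT (val w)
    v⊑w = val (diverging₀ (erase-diverges vτ-diverges))

    w⊑v : eraseT (val w) ⊑ eraseT (val v)
    w⊑v = val (diverging₀ w-diverges)
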